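{- Let $p_k$ denote the $k$-th prime and $s_n=\sum_{k=1}^n(-1)^{n-k}p_k$ for $n\in\mathbb{Z}^+$. Then the numbers $s_1,s_2,s_3,\ldots$ are pairwise distinct, and $s_n\leqslant p_n$ for all $n\in\mathbb{Z}^+$.
   Context: $\mathbb{Z}^+=\{1,2,3,\ldots\}$; $p_1=2,p_2=3,p_3=5,\ldots$. -}

module Defs where

open import Data.Nat using (ℕ; zero; suc; _+_; _!)
open import Data.Nat.Primality using (prime?)
open import Data.Integer as ℤ using (ℤ; +_)
open import Relation.Nullary using (yes; no)

-- firstPrimeFrom m f : the least prime in [m, m + f), or 0 if there is none.
firstPrimeFrom : ℕ → ℕ → ℕ
firstPrimeFrom m zero = 0
firstPrimeFrom m (suc f) with prime? m
... | yes _ = m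
... | no  _ = firstPrimeFrom (suc m) f

-- nextPrime m : the least prime > m.  (By Euclid, some prime lies in
-- (m, m ! + 1], so searching [m+1, m+1+m!) suffices.)
nextPrime : ℕ → ℕ
nextPrime m = firstPrimeFrom (suc m) (m !)

-- pr k = p_k, the k-th prime (1-indexed): p_1 = 2, p_{k+1} = nextPrime p_k.
-- pr 0 is an unused junk value.
pr : ℕ → ℕ
pr zero = 0
pr (suc zero) = 2
pr (suc (suc k)) = nextPrime (pr (suc k))

-- s n = s_n = Σ_{k=1}^{n} (-1)^{n-k} p_k, via s_0 = 0, s_{n} = p_n - s_{n-1}.
s : ℕ → ℤ
s zero = + 0
s (suc n) = + pr (suc n) ℤ.- s n

module Submission where

-- Write q k = p_(k+1) and let a_n = s_(n+1).  Because the
-- primes increase, a_(n+1) = q_(n+1) - a_n never goes negative, so the a_n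
-- are natural numbers with a_n ≤ q_n: this is the bound s_n ≤ p_n.
-- For distinctness two facts about a_n suffice:
--   * a_(n+2) - a_n = q_(n+2) - q_(n+1) > 0, so a is strictly increasing
--     along indices of equal parity;
--   * a_n + a_(n+1) = q_(n+1) is an odd prime, so a_n and a_(n+1) have
--     opposite parities, i.e. parity (a_n) = parity (q_0) + parity n.
-- Hence a_m = a_n forces m and n to have equal parity, and then m = n.

open import Defs
open import Data.Nat using (ℕ; suc)
open import Data.Integer using (_≤_; +_)
open import Data.Product using (_×_)
open import Relation.Binary.PropositionalEquality using (_≡_)
open import Relation.Nullary using (¬_)

open import Data.Nat as ℕ
  using (zero; _+_; _∸_; _<_; _!; parity; z<s; s≤s; NonZero; >-nonZero; nonTrivial⇒n>1; nonTrivial⇒≢1)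
open import Data.Nat.Properties
open import Data.Nat.Divisibility using (_∣_; divides; ∣-refl; ∣-trans; m∣m*n; ∣⇒≤; ∣1⇒≡1; ∣m+n∣m⇒∣n; ∣m∣n⇒∣m+n; m≤n⇒m!∣n!)
open import Data.Nat.Primality using (Prime; composite; prime[2]; prime⇒nonZero; prime⇒nonTrivial; prime?)
open import Data.Nat.Primality.Factorisation using (factorise)
open import Data.Nat.ListAction using (product)
open import Data.List using ([]; _∷_)
open import Data.List.Relation.Unary.All using (_∷_)
open import Data.Parity as ℙ using (0ℙ; 1ℙ; _⁻¹)
open import Data.Parity.Properties as ℙₚ using (+-homo-+; suc-homo-⁻¹; ⁻¹-involutive; p⁻¹+p≡1ℙ)
import Data.Integer as ℤ
import Data.Integer.Properties as ℤₚ
open import Data.Product using (_,_; proj₁; proj₂; ∃-syntax; map₂)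
open import Data.Sum using (inj₁; inj₂)
open import Data.Empty using (⊥-elim)
open import Relation.Nullary using (yes; no; contradiction)
open import Relation.Binary using (tri<; tri≈; tri>)
open import Relation.Binary.PropositionalEquality using (_≢_; refl; sym; trans; cong; subst; module ≡-Reasoning)

prime>1 : ∀ {p} → Prime p → 1 < p
prime>1 {p} pp = nonTrivial⇒n>1 p {{prime⇒nonTrivial pp}}

∣! : ∀ {k m} .{{_ : NonZero k}} → k ℕ.≤ m → k ∣ m !
∣! {suc j} k≤m = ∣-trans (m∣m*n (j !)) (m≤n⇒m!∣n! k≤m)

prime-divisor : ∀ n → 1 < n → ∃[ p ] Prime p × p ∣ n
prime-divisor n 1<n with factorise n {{>-nonZero (<-trans z<s 1<n)}}
... | record { factors = [] ; isFactorisation = n≡1 } =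
  contradiction (sym n≡1) (<⇒≢ 1<n)
... | record { factors = p ∷ ps ; isFactorisation = n≡∏ ; factorsPrime = pp ∷ _ } =
  p , pp , subst (p ∣_) (sym n≡∏) (m∣m*n (product ps))

-- Euclid: a prime divisor of m ! + 1 exceeds m, since it cannot divide m !.
euclid : ∀ m → ∃[ p ] Prime p × m < p × p ℕ.≤ suc (m !)
euclid m with prime-divisor (suc (m !)) (s≤s (1≤n! m))
... | p , pp , p∣1+m! = p , pp , ≰⇒> p≰m , ∣⇒≤ p∣1+m!
  where
  p≰m : ¬ (p ℕ.≤ m)
  p≰m p≤m = nonTrivial⇒≢1 {{prime⇒nonTrivial pp}}
    (∣1⇒≡1 (∣m+n∣m⇒∣n (subst (p ∣_) (+-comm 1 (m !)) p∣1+m!) (∣! {{prime⇒nonZero pp}} p≤m)))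

firstPrimeFrom-spec : ∀ m f {p} → Prime p → m ℕ.≤ p → p < m + f →
                      Prime (firstPrimeFrom m f) × m ℕ.≤ firstPrimeFrom m f
firstPrimeFrom-spec m zero {p} _ m≤p p<m+0 =
  ⊥-elim (<⇒≱ (subst (p <_) (+-identityʳ m) p<m+0) m≤p)
firstPrimeFrom-spec m (suc f) {p} pp m≤p p<m+1+f with prime? m
... | yes pm = pm , ≤-refl
... | no ¬pm with m≤n⇒m<n∨m≡n m≤p
...   | inj₂ refl = contradiction pp ¬pm
...   | inj₁ m<p = map₂ (≤-trans (n≤1+n m))
  (firstPrimeFrom-spec (suc m) f pp m<p (subst (p <_) (+-suc m f) p<m+1+f))

-- For m ≥ 1, nextPrime m is a prime larger than m: Euclid's prime lies in
-- the searched window (m, m + m ! ].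
nextPrime-spec : ∀ m → 1 ℕ.≤ m → Prime (nextPrime m) × m < nextPrime m
nextPrime-spec m 1≤m with euclid m
... | p , pp , m<p , p≤1+m! =
  firstPrimeFrom-spec (suc m) (m !) pp m<p (s≤s (≤-trans p≤1+m! (+-monoˡ-≤ (m !) 1≤m)))

pr-prime : ∀ k → Prime (pr (suc k))
pr-prime zero = prime[2]
pr-prime (suc k) = proj₁ (nextPrime-spec (pr (suc k)) (<⇒≤ (prime>1 (pr-prime k))))

pr-increasing : ∀ k → pr (suc k) < pr (suc (suc k))
pr-increasing k = proj₂ (nextPrime-spec (pr (suc k)) (<⇒≤ (prime>1 (pr-prime k))))

even⇒2∣ : ∀ n → parity n ≡ 0ℙ → 2 ∣ n
even⇒2∣ zero _ = divides zero refl
even⇒2∣ (suc (suc n)) even = ∣m∣n⇒∣m+n ∣-refl (even⇒2∣ n even)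

-- A prime other than 2 is odd: otherwise 2 would be a proper divisor.
odd-prime : ∀ {p} → Prime p → 2 < p → parity p ≡ 1ℙ
odd-prime {p} pp 2<p with parity p in parity≡
... | 1ℙ = refl
... | 0ℙ = contradiction (composite 2<p (even⇒2∣ p parity≡)) (Prime.notComposite pp)

-- p_k is odd for k ≥ 2, being a prime above p_1 = 2.
pr-odd : ∀ k → parity (pr (suc (suc k))) ≡ 1ℙ
pr-odd k = odd-prime (pr-prime (suc k)) (≤-<-trans (prime>1 (pr-prime k)) (pr-increasing k))

parity-suc : ∀ n → parity (suc n) ≡ parity n ⁻¹
parity-suc n = trans (sym (⁻¹-involutive (parity (suc n)))) (cong _⁻¹ (suc-homo-⁻¹ n))

⁻¹-+ : ∀ p r → (p ℙ.+ r) ⁻¹ ≡ p ℙ.+ r ⁻¹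
⁻¹-+ 0ℙ r = refl
⁻¹-+ 1ℙ r = refl

-- alt n = q n - q (n-1) + ... ± q 0, computed by truncated subtraction.
module Alternating (q : ℕ → ℕ) where

  alt : ℕ → ℕ
  alt zero = q zero
  alt (suc n) = q (suc n) ∸ alt n

  alt≤ : ∀ n → alt n ℕ.≤ q n
  alt≤ zero = ≤-refl
  alt≤ (suc n) = m∸n≤m (q (suc n)) (alt n)

  -- For an increasing sequence the subtractions are exact.
  module Increasing (q-increasing : ∀ n → q n < q (suc n)) where

    -- Each alternating sum fits under the next term, so the next
    -- subtraction does not truncate.
    alt≤next : ∀ n → alt n ℕ.≤ q (suc n)
    alt≤next n = ≤-trans (alt≤ n) (<⇒≤ (q-increasing n))

    alt-complement : ∀ n → alt (suc n) + alt n ≡ q (suc n)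
    alt-complement n = m∸n+n≡m (alt≤next n)

    -- a_(n+2) = a_n + (q_(n+2) - q_(n+1)) > a_n.
    alt-step : ∀ n → alt n < alt (suc (suc n))
    alt-step n = m+n≤o⇒m≤o∸n (suc (alt n)) (begin
      suc (alt n + alt (suc n)) ≡⟨ cong suc (+-comm (alt n) (alt (suc n))) ⟩
      suc (alt (suc n) + alt n) ≡⟨ cong suc (alt-complement n) ⟩
      suc (q (suc n))           ≤⟨ q-increasing (suc n) ⟩
      q (suc (suc n))           ∎)
      where open ≤-Reasoning

    alt-gap : ∀ d m → parity (suc d) ≡ 0ℙ → alt m < alt (suc d + m)
    alt-gap zero m ()
    alt-gap (suc zero) m _ = alt-step m
    alt-gap (suc (suc d)) m even = <-trans (alt-gap d m even) (alt-step (suc d + m))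

    -- If moreover every term after the first is odd, the parity of a_n
    -- is determined by the parity of n.
    module OddTail (q-odd : ∀ n → parity (q (suc n)) ≡ 1ℙ) where

      alt-parity-flip : ∀ n → parity (alt (suc n)) ≡ parity (alt n) ⁻¹
      alt-parity-flip n = ℙₚ.+-cancelʳ-≡ (parity (alt n)) _ _ (begin
        parity (alt (suc n)) ℙ.+ parity (alt n) ≡⟨ +-homo-+ (alt (suc n)) (alt n) ⟨
        parity (alt (suc n) + alt n)            ≡⟨ cong parity (alt-complement n) ⟩
        parity (q (suc n))                      ≡⟨ q-odd n ⟩
        1ℙ                                      ≡⟨ p⁻¹+p≡1ℙ (parity (alt n)) ⟨
        parity (alt n) ⁻¹ ℙ.+ parity (alt n)    ∎)
        where open ≡-Reasoning

      alt-parity : ∀ n → parity (alt n) ≡ parity (q 0) ℙ.+ parity n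
      alt-parity zero = sym (ℙₚ.+-identityʳ (parity (q 0)))
      alt-parity (suc n) = begin
        parity (alt (suc n))               ≡⟨ alt-parity-flip n ⟩
        parity (alt n) ⁻¹                  ≡⟨ cong _⁻¹ (alt-parity n) ⟩
        (parity (q 0) ℙ.+ parity n) ⁻¹     ≡⟨ ⁻¹-+ (parity (q 0)) (parity n) ⟩
        parity (q 0) ℙ.+ parity n ⁻¹       ≡⟨ cong (parity (q 0) ℙ.+_) (parity-suc n) ⟨
        parity (q 0) ℙ.+ parity (suc n)    ∎
        where open ≡-Reasoning

      alt-same-parity : ∀ {m n} → alt m ≡ alt n → parity m ≡ parity n
      alt-same-parity {m} {n} eq = ℙₚ.+-cancelˡ-≡ (parity (q 0)) (parity m) (parity n)
        (trans (sym (alt-parity m)) (trans (cong parity eq) (alt-parity n)))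

      -- a_m differs from every later a_(m+k+1): an odd shift changes the
      -- parity, an even one strictly increases the value.
      alt-shift-injective : ∀ k m → alt m ≢ alt (suc k + m)
      alt-shift-injective k m eq = <-irrefl eq (alt-gap k m even-shift)
        where
        even-shift : parity (suc k) ≡ 0ℙ
        even-shift = ℙₚ.+-cancelʳ-≡ (parity m) (parity (suc k)) 0ℙ
          (trans (sym (+-homo-+ (suc k) m)) (sym (alt-same-parity {m} {suc k + m} eq)))

      alt-<-injective : ∀ {m n} → m < n → alt m ≢ alt n
      alt-<-injective {m} m<n eq with m≤n⇒∃[o]m+o≡n m<n
      ... | k , refl = alt-shift-injective k m (trans eq (cong alt (cong suc (+-comm m k))))

      alt-injective : ∀ {m n} → alt m ≡ alt n → m ≡ n
      alt-injective {m} {n} eq with <-cmp m n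
      ... | tri< m<n _ _ = contradiction eq (alt-<-injective m<n)
      ... | tri≈ _ m≡n _ = m≡n
      ... | tri> _ _ n<m = contradiction (sym eq) (alt-<-injective n<m)

P : ℕ → ℕ
P k = pr (suc k)

open Alternating P
open Increasing pr-increasing
open OddTail pr-odd

-- s_(n+1) = a_n, using that the subtractions are exact.
s-alt : ∀ n → s (suc n) ≡ + alt n
s-alt zero = refl
s-alt (suc n) = begin
  + P (suc n) ℤ.- s (suc n)   ≡⟨ cong (λ i → + P (suc n) ℤ.- i) (s-alt n) ⟩
  + P (suc n) ℤ.- + alt n     ≡⟨ ℤₚ.m-n≡m⊖n (P (suc n)) (alt n) ⟩
  P (suc n) ℤ.⊖ alt n         ≡⟨ ℤₚ.⊖-≥ (alt≤next n) ⟩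
  + (P (suc n) ∸ alt n)       ∎
  where open ≡-Reasoning

lemma4p4 : ((m n : ℕ) → ¬ (m ≡ n) → ¬ (s (suc m) ≡ s (suc n)))
           × ((n : ℕ) → s (suc n) ≤ + pr (suc n))
lemma4p4 = distinct , bounded
  where
  distinct : (m n : ℕ) → ¬ (m ≡ n) → ¬ (s (suc m) ≡ s (suc n))
  distinct m n m≢n eq =
    m≢n (alt-injective (ℤₚ.+-injective (trans (sym (s-alt m)) (trans eq (s-alt n)))))

  bounded : (n : ℕ) → s (suc n) ≤ + pr (suc n)
  bounded n = subst (_≤ + pr (suc n)) (sym (s-alt n)) (ℤ.+≤+ (alt≤ n))
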